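{- Let $D=(V,A)$ be a digraph and $\mathcal{L}\subseteq 2^V$ a laminar family with $V\in\mathcal{L}$. For any $\mathcal{L}$-tight arborescence $B$ of $D$ and any $F\in\mathcal{L}$, $B[F]$ is an $\mathcal{L}[F]$-tight arborescence in $D[F]$.
   Context: A (spanning) arborescence of a digraph is an arc set which is a spanning tree in the undirected sense in which every node has in-degree at most one; the node of in-degree $0$ is its root. $B$ is $\mathcal{L}$-tight if $|\delta^{in}_B(F)|\le 1$ for all $F\in\mathcal{L}$ and $|\delta^{in}_B(F)|=0$ for all $F\in\mathcal{L}$ containing the root of $B$. $D[F]$ is the subdigraph induced by $F$, $B[F]$ is obtained from $(V,B)$ by deleting the nodes of $V\setminus F$, and $\mathcal{L}[F]=\{F'\in\mathcal{L}:F'\subseteq F\}$. -}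

module Defs where

open import Data.Nat using (ℕ; _≤_)
open import Data.Fin using (Fin)
open import Data.Fin.Subset using (Subset; _∈_; _∉_; _⊆_; _∩_; ∁; ∣_∣; ⁅_⁆; ⊤; Empty)
open import Data.Vec using (lookup; tabulate)
open import Data.List using (List; []; _∷_)
open import Data.List.Relation.Unary.Unique.Propositional using (Unique)
import Data.List.Membership.Propositional as LM
open import Data.Sum using (_⊎_)
open import Data.Product using (_×_; Σ)
open import Relation.Binary.PropositionalEquality using (_≡_; _≢_)

-- A digraph on node set Fin n with m arcs (parallel arcs and loops allowed);
-- arc a goes from tail a to head a.
record Digraph (n m : ℕ) : Set where
  field
    tail : Fin m → Fin n
    head : Fin m → Fin n
open Digraph public

module _ {n m : ℕ} (D : Digraph n m) where

  headIn : Subset n → Subset m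
  headIn X = tabulate (λ a → lookup X (head D a))

  tailIn : Subset n → Subset m
  tailIn X = tabulate (λ a → lookup X (tail D a))

  arcsWithin : Subset n → Subset m
  arcsWithin S = headIn S ∩ tailIn S

  restrict : Subset m → Subset n → Subset m
  restrict B S = B ∩ arcsWithin S

  δin : Subset m → Subset n → Subset m
  δin B F = B ∩ (headIn F ∩ ∁ (tailIn F))

  data Walk (B : Subset m) : Fin n → Fin n → List (Fin m) → Set where
    nil  : ∀ {u} → Walk B u u []
    fwd  : ∀ {v as} (a : Fin m) → a ∈ B → Walk B (head D a) v as → Walk B (tail D a) v (a ∷ as)
    bwd  : ∀ {v as} (a : Fin m) → a ∈ B → Walk B (tail D a) v as → Walk B (head D a) v (a ∷ as)

  Connected : Subset n → Subset m → Set
  Connected S B = ∀ u v → u ∈ S → v ∈ S → Σ (List (Fin m)) (Walk B u v)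

  Acyclic : Subset m → Set
  Acyclic B = ∀ u as → Walk B u u as → Unique as → as ≡ []

  -- B is a spanning arborescence of D[S]: B ⊆ arcs of D[S], (S,B) is a spanning
  -- tree in the undirected sense, every node of S has in-degree ≤ 1 in B
  IsArborescence : Subset n → Subset m → Set
  IsArborescence S B =
    B ⊆ arcsWithin S × Connected S B × Acyclic B
    × (∀ v → v ∈ S → ∣ δin B ⁅ v ⁆ ∣ ≤ 1)

  IsRoot : Subset n → Subset m → Fin n → Set
  IsRoot S B r = r ∈ S × ∣ δin B ⁅ r ⁆ ∣ ≡ 0

  -- B is L[S]-tight (with L[S] = members of L contained in S)
  IsTight : List (Subset n) → Subset n → Subset m → Set
  IsTight L S B =
    (∀ F → F LM.∈ L → F ⊆ S → ∣ δin B F ∣ ≤ 1)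
    × (∀ F r → F LM.∈ L → F ⊆ S → IsRoot S B r → r ∈ F → ∣ δin B F ∣ ≡ 0)

Laminar : {n : ℕ} → List (Subset n) → Set
Laminar L = ∀ X Y → X LM.∈ L → Y LM.∈ L → X ⊆ Y ⊎ (Y ⊆ X ⊎ Empty (X ∩ Y))

-- B is acyclic with all indegrees at most 1. Climbing from a node of F against the arcs
-- of B, one stays in F until reaching a node t that is either a root of B or the head of
-- an arc of B entering F; the climb terminates because, by acyclicity, it never reuses
-- an arc. There is only one root: along a walk from a root, a backward step can only
-- undo the preceding forward step. Tightness then makes t independent of the starting
-- node (at most one arc of B enters F, and none if the root lies in F), so B[F] is
-- connected through t. A root of B[F] is such a node t as well; if it lies in F' ⊆ F,
-- the only arc of B that could enter F' is the one entering F at t, which is not in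
-- B[F], so no arc of B[F] enters F'.
module Submission where

open import Defs
open import Data.Nat using (ℕ; zero; suc; _≤_; _<_; _+_; z≤n)
open import Data.Nat.Properties using (≤-trans; ≤-<-trans; +-suc; +-identityʳ; n≮0; 1+n≰n)
open import Data.Fin using (Fin; zero; suc; toℕ) renaming (_≟_ to _≟ᶠ_)
open import Data.Fin.Properties using (any?; injective⇒≤)
open import Data.Fin.Subset using (Subset; _∈_; _∉_; _⊆_; ∣_∣; ⁅_⁆; ⊤; _⊂_; Empty)
open import Data.Fin.Subset.Properties
  using (_∈?_; ∈⊤; ⊆⊤; x∈p∩q⁺; x∈p∩q⁻; x∉p⇒x∈∁p; x∈∁p⇒x∉p; x∈⁅x⁆; x∈⁅y⁆⇒x≡y; x≢y⇒x∉⁅y⁆; ∣⁅x⁆∣≡1; p⊂q⇒∣p∣<∣q∣;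
         p⊆q⇒∣p∣≤∣q∣; x∈p⇒∣p-x∣<∣p∣; Empty-unique; ∣⊥∣≡0)
open import Data.Vec using (lookup; tabulate)
open import Data.Vec.Properties using (lookup∘tabulate; []=⇒lookup; lookup⇒[]=)
open import Data.List using (List; []; _∷_; _++_; length; take)
import Data.List as List
open import Data.List.Relation.Unary.Any using (here; there; index)
import Data.List.Relation.Unary.All as All
open import Data.List.Relation.Unary.All using ([]; _∷_)
open import Data.List.Relation.Unary.All.Properties using (¬Any⇒All¬)
open import Data.List.Relation.Unary.AllPairs using ([]; _∷_)
open import Data.List.Relation.Unary.Unique.Propositional using (Unique)
open import Data.List.Relation.Unary.Unique.Propositional.Properties using (take⁺)
open import Data.List.Membership.Propositional using () renaming (_∈_ to _∈ᴸ_)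
open import Data.List.Membership.Propositional.Properties using (∈-lookup)
open import Data.Sum using (_⊎_; inj₁; inj₂)
open import Data.Product using (_×_; Σ; _,_; proj₁; proj₂)
open import Data.Empty using (⊥; ⊥-elim)
open import Relation.Nullary using (¬_; Dec; yes; no; contradiction)
open import Relation.Nullary.Decidable using (_×-dec_)
open import Relation.Binary.PropositionalEquality using (_≡_; _≢_; refl; sym; trans; cong; subst)

module _ {n : ℕ} where

  x∈p⇒0<∣p∣ : ∀ {x} {p : Subset n} → x ∈ p → 0 < ∣ p ∣
  x∈p⇒0<∣p∣ x∈p = ≤-<-trans z≤n (x∈p⇒∣p-x∣<∣p∣ x∈p)

  ∣p∣≡0⇒x∉p : ∀ {x} {p : Subset n} → ∣ p ∣ ≡ 0 → x ∉ p
  ∣p∣≡0⇒x∉p ∣p∣≡0 x∈p = n≮0 (subst (0 <_) ∣p∣≡0 (x∈p⇒0<∣p∣ x∈p))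

  Empty⇒∣p∣≡0 : ∀ {p : Subset n} → Empty p → ∣ p ∣ ≡ 0
  Empty⇒∣p∣≡0 empty = trans (cong ∣_∣ (Empty-unique empty)) (∣⊥∣≡0 n)

  ∣p∣≤1⇒x≡y : ∀ {x y} {p : Subset n} → ∣ p ∣ ≤ 1 → x ∈ p → y ∈ p → x ≡ y
  ∣p∣≤1⇒x≡y {x} {y} {p} ∣p∣≤1 x∈p y∈p with x ≟ᶠ y
  ... | yes x≡y = x≡y
  ... | no x≢y = ⊥-elim (1+n≰n (≤-trans (subst (_< ∣ p ∣) (∣⁅x⁆∣≡1 y) (p⊂q⇒∣p∣<∣q∣ ⁅y⁆⊂p)) ∣p∣≤1))
    where
    ⁅y⁆⊂p : ⁅ y ⁆ ⊂ p
    ⁅y⁆⊂p = (λ z∈⁅y⁆ → subst (_∈ p) (sym (x∈⁅y⁆⇒x≡y y z∈⁅y⁆)) y∈p)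
          , x , x∈p , x≢y⇒x∉⁅y⁆ x≢y

  ∈-tabulate⁺ : ∀ {k} (X : Subset n) (f : Fin k → Fin n) {a} →
                f a ∈ X → a ∈ tabulate (λ b → lookup X (f b))
  ∈-tabulate⁺ X f {a} fa∈X = lookup⇒[]= a _ (trans (lookup∘tabulate _ a) ([]=⇒lookup fa∈X))

  ∈-tabulate⁻ : ∀ {k} (X : Subset n) (f : Fin k → Fin n) {a} →
                a ∈ tabulate (λ b → lookup X (f b)) → f a ∈ X
  ∈-tabulate⁻ X f {a} a∈ = lookup⇒[]= (f a) X (trans (sym (lookup∘tabulate _ a)) ([]=⇒lookup a∈))

module _ {k : ℕ} where

  Unique⇒lookup-injective : ∀ {xs : List (Fin k)} → Unique xs →
                            ∀ i j → List.lookup xs i ≡ List.lookup xs j → i ≡ j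
  Unique⇒lookup-injective (_ ∷ _) zero zero _ = refl
  Unique⇒lookup-injective (x∉ ∷ _) zero (suc j) eq = contradiction eq (All.lookup x∉ (∈-lookup j))
  Unique⇒lookup-injective (x∉ ∷ _) (suc i) zero eq = contradiction (sym eq) (All.lookup x∉ (∈-lookup i))
  Unique⇒lookup-injective (_ ∷ u) (suc i) (suc j) eq = cong suc (Unique⇒lookup-injective u i j eq)

  Unique⇒length≤ : ∀ {xs : List (Fin k)} → Unique xs → length xs ≤ k
  Unique⇒length≤ u = injective⇒≤ (Unique⇒lookup-injective u _ _)

module DigraphProperties {n m : ℕ} (D : Digraph n m) where

  ∈δin⁺ : ∀ {C X a} → a ∈ C → head D a ∈ X → tail D a ∉ X → a ∈ δin D C X
  ∈δin⁺ {C} {X} a∈C h∈X t∉X =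
    x∈p∩q⁺ (a∈C , x∈p∩q⁺ (∈-tabulate⁺ X (head D) h∈X ,
                          x∉p⇒x∈∁p (λ t∈ → t∉X (∈-tabulate⁻ X (tail D) t∈))))

  ∈δin⁻ : ∀ C X {a} → a ∈ δin D C X → a ∈ C × head D a ∈ X × tail D a ∉ X
  ∈δin⁻ C X a∈ with x∈p∩q⁻ C _ a∈
  ... | a∈C , a∈′ with x∈p∩q⁻ _ _ a∈′
  ... | h∈ , t∈∁ = a∈C , ∈-tabulate⁻ X (head D) h∈ , λ t∈X → x∈∁p⇒x∉p t∈∁ (∈-tabulate⁺ X (tail D) t∈X)

  ∈restrict⁺ : ∀ {C F a} → a ∈ C → head D a ∈ F → tail D a ∈ F → a ∈ restrict D C F
  ∈restrict⁺ {C} {F} a∈C h∈F t∈F =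
    x∈p∩q⁺ (a∈C , x∈p∩q⁺ (∈-tabulate⁺ F (head D) h∈F , ∈-tabulate⁺ F (tail D) t∈F))

  restrict⊆ : ∀ C F → restrict D C F ⊆ C
  restrict⊆ C F a∈ = proj₁ (x∈p∩q⁻ C _ a∈)

  restrict⊆arcsWithin : ∀ C F → restrict D C F ⊆ arcsWithin D F
  restrict⊆arcsWithin C F a∈ = proj₂ (x∈p∩q⁻ C _ a∈)

  tail∈restrict : ∀ C F {a} → a ∈ restrict D C F → tail D a ∈ F
  tail∈restrict C F a∈ = ∈-tabulate⁻ F (tail D) (proj₂ (x∈p∩q⁻ _ _ (restrict⊆arcsWithin C F a∈)))

  δin-mono : ∀ {C C′} X → C ⊆ C′ → δin D C X ⊆ δin D C′ X
  δin-mono {C} {C′} X C⊆C′ a∈ =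
    let a∈C , h∈ , t∉ = ∈δin⁻ C X a∈ in ∈δin⁺ {C′} {X} (C⊆C′ a∈C) h∈ t∉

  Walk-mono : ∀ {C C′ x y as} → C ⊆ C′ → Walk D C x y as → Walk D C′ x y as
  Walk-mono C⊆C′ nil = nil
  Walk-mono C⊆C′ (fwd a a∈ W) = fwd a (C⊆C′ a∈) (Walk-mono C⊆C′ W)
  Walk-mono C⊆C′ (bwd a a∈ W) = bwd a (C⊆C′ a∈) (Walk-mono C⊆C′ W)

  Acyclic-mono : ∀ {C C′} → C ⊆ C′ → Acyclic D C′ → Acyclic D C
  Acyclic-mono C⊆C′ acyclic u as W = acyclic u as (Walk-mono C⊆C′ W)

  _++ʷ_ : ∀ {C x y z as bs} → Walk D C x y as → Walk D C y z bs → Walk D C x z (as ++ bs)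
  nil ++ʷ W′ = W′
  fwd a a∈ W ++ʷ W′ = fwd a a∈ (W ++ʷ W′)
  bwd a a∈ W ++ʷ W′ = bwd a a∈ (W ++ʷ W′)

  data Path (C : Subset m) : Fin n → Fin n → List (Fin m) → Set where
    []   : ∀ {u} → Path C u u []
    step : ∀ {v as} (a : Fin m) → a ∈ C → Path C (head D a) v as → Path C (tail D a) v (a ∷ as)

  Path-mono : ∀ {C C′ x y as} → C ⊆ C′ → Path C x y as → Path C′ x y as
  Path-mono C⊆C′ [] = []
  Path-mono C⊆C′ (step a a∈ P) = step a (C⊆C′ a∈) (Path-mono C⊆C′ P)

  Path⇒Walk : ∀ {C x y as} → Path C x y as → Walk D C x y as
  Path⇒Walk [] = nil
  Path⇒Walk (step a a∈ P) = fwd a a∈ (Path⇒Walk P)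

  Path⇒reverseWalk : ∀ {C x y as} → Path C x y as → Σ (List (Fin m)) (Walk D C y x)
  Path⇒reverseWalk [] = [] , nil
  Path⇒reverseWalk (step a a∈ P) = _ , (proj₂ (Path⇒reverseWalk P) ++ʷ bwd a a∈ nil)

  Path-snoc : ∀ {C x a as} → Path C x (tail D a) as → a ∈ C → Σ (List (Fin m)) (Path C x (head D a))
  Path-snoc {a = a} [] a∈ = _ , step a a∈ []
  Path-snoc (step b b∈ P) a∈ = _ , step b b∈ (proj₂ (Path-snoc P a∈))

  Path-upTo : ∀ {C x y c as} (c∈as : c ∈ᴸ as) → Path C x y as →
              Path C x (head D c) (take (suc (toℕ (index c∈as))) as)
  Path-upTo (here refl) (step a a∈ P) = step a a∈ []
  Path-upTo (there c∈as) (step a a∈ P) = step a a∈ (Path-upTo c∈as P)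

module Branching {n m : ℕ} (D : Digraph n m) (B : Subset m) (acyclic : Acyclic D B)
                 (indeg≤1 : ∀ v → ∣ δin D B ⁅ v ⁆ ∣ ≤ 1) where

  open DigraphProperties D
  open import Data.List.Membership.DecPropositional (_≟ᶠ_ {m}) using () renaming (_∈?_ to _∈ᴸ?_)

  HasInArc : Fin n → Set
  HasInArc v = Σ (Fin m) λ a → a ∈ B × head D a ≡ v

  hasInArc? : ∀ v → Dec (HasInArc v)
  hasInArc? v = any? (λ a → (a ∈? B) ×-dec (head D a ≟ᶠ v))

  -- δin D B ⁅ v ⁆ does not count loops at v; acyclicity excludes them.
  no-loop : ∀ {a} → a ∈ B → tail D a ≢ head D a
  no-loop {a} a∈B t≡h with acyclic (head D a) (a ∷ [])
                                   (subst (λ z → Walk D B z (head D a) (a ∷ [])) t≡h (fwd a a∈B nil))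
                                   ([] ∷ [])
  ... | ()

  ∈δin⁅head⁆ : ∀ {C a} → a ∈ B → a ∈ C → a ∈ δin D C ⁅ head D a ⁆
  ∈δin⁅head⁆ a∈B a∈C = ∈δin⁺ a∈C (x∈⁅x⁆ _) (λ t∈ → no-loop a∈B (x∈⁅y⁆⇒x≡y _ t∈))

  inArc-unique : ∀ {a b} → a ∈ B → b ∈ B → head D a ≡ head D b → a ≡ b
  inArc-unique {a} {b} a∈B b∈B ha≡hb =
    ∣p∣≤1⇒x≡y (indeg≤1 (head D a)) (∈δin⁅head⁆ a∈B a∈B)
              (subst (λ z → b ∈ δin D B ⁅ z ⁆) (sym ha≡hb) (∈δin⁅head⁆ b∈B b∈B))

  ¬HasInArc⇒∣δin∣≡0 : ∀ {v} → ¬ HasInArc v → ∣ δin D B ⁅ v ⁆ ∣ ≡ 0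
  ¬HasInArc⇒∣δin∣≡0 noArc = Empty⇒∣p∣≡0 λ (a , a∈) →
    let a∈B , h∈ , _ = ∈δin⁻ B ⁅ _ ⁆ a∈ in noArc (a , a∈B , x∈⁅y⁆⇒x≡y _ h∈)

  Path⇒≡⊎HasInArc : ∀ {x y as} → Path B x y as → x ≡ y ⊎ HasInArc y
  Path⇒≡⊎HasInArc [] = inj₁ refl
  Path⇒≡⊎HasInArc (step a a∈B P) with Path⇒≡⊎HasInArc P
  ... | inj₁ ha≡y = inj₂ (a , a∈B , ha≡y)
  ... | inj₂ arc = inj₂ arc

  -- Not necessarily P without its last arc: P is cut at the first occurrence of a.
  Path-retreat : ∀ {x a as} → Path B x (head D a) as → a ∈ B →
                 x ≡ head D a ⊎ Σ (List (Fin m)) (Path B x (tail D a))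
  Path-retreat [] _ = inj₁ refl
  Path-retreat (step b b∈B P) a∈B with Path-retreat P a∈B
  ... | inj₁ hb≡ha = inj₂ (_ , subst (λ c → Path B (tail D b) (tail D c) []) (inArc-unique b∈B a∈B hb≡ha) [])
  ... | inj₂ (_ , P′) = inj₂ (_ , step b b∈B P′)

  -- Since indegrees are at most 1, a backward step along a walk from a root can only
  -- undo the last arc of the directed path followed so far.
  Path-extend : ∀ {x u y as bs} → ¬ HasInArc x → Path B x u as → Walk D B u y bs →
                Σ (List (Fin m)) (Path B x y)
  Path-extend _ P nil = _ , P
  Path-extend x-root P (fwd a a∈B W) = Path-extend x-root (proj₂ (Path-snoc P a∈B)) W
  Path-extend x-root P (bwd a a∈B W) with Path-retreat P a∈B
  ... | inj₁ x≡ha = ⊥-elim (x-root (a , a∈B , sym x≡ha))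
  ... | inj₂ (_ , P′) = Path-extend x-root P′ W

  roots-connected⇒≡ : ∀ {x y as} → ¬ HasInArc x → ¬ HasInArc y → Walk D B x y as → x ≡ y
  roots-connected⇒≡ x-root y-root W with Path⇒≡⊎HasInArc (proj₂ (Path-extend x-root [] W))
  ... | inj₁ x≡y = x≡y
  ... | inj₂ arc = ⊥-elim (y-root arc)

  closing-arc⇒⊥ : ∀ {w v c as} → Unique as → Path B w v as → c ∈ᴸ as → head D c ≡ w → ⊥
  closing-arc⇒⊥ u [] () _
  closing-arc⇒⊥ {w} u P@(step _ _ _) c∈as hc≡w
    with acyclic w _ (subst (λ z → Walk D B w z _) hc≡w (Path⇒Walk (Path-upTo c∈as P))) (take⁺ _ u)
  ... | ()

  Top : Subset n → Fin n → Set
  Top F t = t ∈ F × (¬ HasInArc t ⊎ Σ (Fin m) λ a → a ∈ δin D B F × head D a ≡ t)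

  restrict-root⇒Top : ∀ {F r} → r ∈ F → ∣ δin D (restrict D B F) ⁅ r ⁆ ∣ ≡ 0 → Top F r
  restrict-root⇒Top {F} {r} r∈F r-root with hasInArc? r
  ... | no noArc = r∈F , inj₁ noArc
  ... | yes (b , b∈B , hb≡r) with tail D b ∈? F
  ...   | no tb∉F = r∈F , inj₂ (b , ∈δin⁺ b∈B (subst (_∈ F) (sym hb≡r) r∈F) tb∉F , hb≡r)
  ...   | yes tb∈F = ⊥-elim (∣p∣≡0⇒x∉p r-root (subst (λ z → b ∈ δin D (restrict D B F) ⁅ z ⁆) hb≡r
                                                       (∈δin⁅head⁆ b∈B b∈B[F])))
    where
    b∈B[F] : b ∈ restrict D B F
    b∈B[F] = ∈restrict⁺ b∈B (subst (_∈ F) (sym hb≡r) r∈F) tb∈F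

  Top⇒∣δin∣≡0 : ∀ {F F′ r} → F′ ⊆ F → ∣ δin D B F′ ∣ ≤ 1 →
                (¬ HasInArc r → ∣ δin D B F′ ∣ ≡ 0) → r ∈ F′ → Top F r →
                ∣ δin D (restrict D B F) F′ ∣ ≡ 0
  Top⇒∣δin∣≡0 {F} {F′} _ _ root⇒δin≡0 _ (_ , inj₁ noArc) = Empty⇒∣p∣≡0 λ (a , a∈) →
    ∣p∣≡0⇒x∉p (root⇒δin≡0 noArc) (δin-mono F′ (restrict⊆ B F) a∈)
  Top⇒∣δin∣≡0 {F} {F′} F′⊆F δin≤1 _ r∈F′ (_ , inj₂ (b , b∈δin , hb≡r)) = Empty⇒∣p∣≡0 λ (a , a∈) →
    let b∈B , _ , tb∉F = ∈δin⁻ B F b∈δin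
        a∈B[F] , _ = ∈δin⁻ (restrict D B F) F′ a∈
        b∈δin′ = ∈δin⁺ b∈B (subst (_∈ F′) (sym hb≡r) r∈F′) (λ tb∈F′ → tb∉F (F′⊆F tb∈F′))
        a≡b = ∣p∣≤1⇒x≡y δin≤1 (δin-mono F′ (restrict⊆ B F) a∈) b∈δin′
    in tb∉F (subst (λ c → tail D c ∈ F) a≡b (tail∈restrict B F a∈B[F]))

  module _ (F : Subset n) where

    -- The fuel k bounds the number of further steps: the arcs climbed so far are
    -- distinct, so there are at most m of them.
    climb : ∀ k {w v as} → k + length as ≡ m → Unique as → w ∈ F → Path (restrict D B F) w v as →
            Σ (Fin n) λ t → Top F t × Σ (List (Fin m)) (Path (restrict D B F) t v)
    climb k {w} {v} {as} fuel u w∈F P with hasInArc? w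
    ... | no noArc = w , (w∈F , inj₁ noArc) , _ , P
    ... | yes (c , c∈B , hc≡w) with tail D c ∈? F
    ...   | no tc∉F = w , (w∈F , inj₂ (c , ∈δin⁺ c∈B (subst (_∈ F) (sym hc≡w) w∈F) tc∉F , hc≡w)) , _ , P
    ...   | yes tc∈F with c ∈ᴸ? as
    ...     | yes c∈as = ⊥-elim (closing-arc⇒⊥ u (Path-mono (restrict⊆ B F) P) c∈as hc≡w)
    ...     | no c∉as with k
    ...       | zero = ⊥-elim (1+n≰n (subst (λ l → suc l ≤ m) fuel (Unique⇒length≤ (¬Any⇒All¬ as c∉as ∷ u))))
    ...       | suc k =
      climb k (trans (+-suc k (length as)) fuel) (¬Any⇒All¬ as c∉as ∷ u) tc∈F
        (step c (∈restrict⁺ c∈B (subst (_∈ F) (sym hc≡w) w∈F) tc∈F)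
                (subst (λ z → Path (restrict D B F) z v as) (sym hc≡w) P))

    climbToTop : ∀ {v} → v ∈ F → Σ (Fin n) λ t → Top F t × Σ (List (Fin m)) (Path (restrict D B F) t v)
    climbToTop v∈F = climb m (+-identityʳ m) [] v∈F []

    module _ (conn : Connected D ⊤ B) (δin≤1 : ∣ δin D B F ∣ ≤ 1)
             (root⇒δin≡0 : ∀ {r} → ¬ HasInArc r → r ∈ F → ∣ δin D B F ∣ ≡ 0) where

      Top-unique : ∀ {s t} → Top F s → Top F t → s ≡ t
      Top-unique {s} {t} (_ , inj₁ s-root) (_ , inj₁ t-root) =
        roots-connected⇒≡ s-root t-root (proj₂ (conn s t ∈⊤ ∈⊤))
      Top-unique (s∈F , inj₁ s-root) (_ , inj₂ (a , a∈ , _)) =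
        ⊥-elim (∣p∣≡0⇒x∉p (root⇒δin≡0 s-root s∈F) a∈)
      Top-unique (_ , inj₂ (a , a∈ , _)) (t∈F , inj₁ t-root) =
        ⊥-elim (∣p∣≡0⇒x∉p (root⇒δin≡0 t-root t∈F) a∈)
      Top-unique (_ , inj₂ (a , a∈ , ha≡s)) (_ , inj₂ (b , b∈ , hb≡t)) =
        trans (sym ha≡s) (trans (cong (head D) (∣p∣≤1⇒x≡y δin≤1 a∈ b∈)) hb≡t)

      restrict-connected : Connected D F (restrict D B F)
      restrict-connected u v u∈F v∈F with climbToTop u∈F | climbToTop v∈F
      ... | s , s-top , _ , Ps | t , t-top , _ , Pt =
        _ , (proj₂ (Path⇒reverseWalk Ps)
              ++ʷ subst (λ z → Walk D (restrict D B F) z v _) (sym (Top-unique s-top t-top)) (Path⇒Walk Pt))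

claim4 : {n m : ℕ} (D : Digraph n m) (L : List (Subset n)) →
    Laminar L → ⊤ ∈ᴸ L →
    (B : Subset m) → IsArborescence D ⊤ B → IsTight D L ⊤ B →
    (F : Subset n) → F ∈ᴸ L →
    IsArborescence D F (restrict D B F) × IsTight D L F (restrict D B F)
claim4 D L _ _ B (_ , conn , acyclic , indeg≤1) (δin≤1 , root⇒δin≡0) F F∈L =
    ( restrict⊆arcsWithin B F
    , restrict-connected F conn (δin≤1 F F∈L ⊆⊤) (root∈⇒∣δin∣≡0 F∈L)
    , Acyclic-mono (restrict⊆ B F) acyclic
    , λ v _ → ≤-trans (p⊆q⇒∣p∣≤∣q∣ (δin-mono ⁅ v ⁆ (restrict⊆ B F))) (indeg≤1 v ∈⊤) )
  , (λ F′ F′∈L _ → ≤-trans (p⊆q⇒∣p∣≤∣q∣ (δin-mono F′ (restrict⊆ B F))) (δin≤1 F′ F′∈L ⊆⊤))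
  , λ F′ r F′∈L F′⊆F (r∈F , r-root) r∈F′ →
      Top⇒∣δin∣≡0 F′⊆F (δin≤1 F′ F′∈L ⊆⊤) (λ noArc → root∈⇒∣δin∣≡0 F′∈L noArc r∈F′) r∈F′
                  (restrict-root⇒Top r∈F r-root)
  where
  open DigraphProperties D
  open Branching D B acyclic (λ v → indeg≤1 v ∈⊤)

  root∈⇒∣δin∣≡0 : ∀ {X r} → X ∈ᴸ L → ¬ HasInArc r → r ∈ X → ∣ δin D B X ∣ ≡ 0
  root∈⇒∣δin∣≡0 {X} {r} X∈L noArc = root⇒δin≡0 X r X∈L ⊆⊤ (∈⊤ , ¬HasInArc⇒∣δin∣≡0 noArc)
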